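{- Let $m\ge 1$ be an integer and $g=30m+7$. There exists an almost $5$-star factor $F$ on $\{0,1,\dots,g-1\}=\{0,1,\dots,30m+6\}$ with $t=1$ isolated vertex such that: (i) every $d\in\{1,2,\dots,15m+3\}$ is the forward difference of at least one edge of $F$; (ii) every $d\in\{1,2,\dots,15m+3\}$ is the forward difference of at most two edges of $F$; (iii) $F$ has no wrap-around edges; (iv) there is a pure/prime labelling of $F$ with respect to which exactly one of the $5$-star components of $F$ is mixed.
   Context: Let $g\ge 1$ and $t\in\{0,\dots,5\}$ with $g\equiv t\pmod 6$. An almost $5$-star factor on $\{0,1,\dots,g-1\}$ with $t$ isolated vertices is a graph $F$ on this vertex set such that the vertex set is partitioned into $(g-t)/6$ six-element sets, each spanning a connected component of $F$ isomorphic to $K_{1,5}$ (a $5$-star), and one $t$-element set $X$ (the isolated vertices) on which $F$ induces a star $K_{1,t-1}$ (the little star; for $t=1$ it is a single vertex, for $t=2$ a single edge), and $F$ has no other edges. For an edge $\{u,w\}$ with $u<w$, its difference is $\min\{w-u,\,g-(w-u)\}$; the edge is a forward edge if its difference equals $w-u$ (and then $w-u$ is its forward difference), and a wrap-around edge otherwise. A pure/prime labelling of $F$ assigns to each edge of $F$ one of the labels "pure" or "prime" so that no two pure edges have the same difference and no two prime edges have the same difference. With respect to such a labelling, a star is pure (resp. prime) if all its edges are pure (resp. prime), and mixed if it contains both a pure and a prime edge. -}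

module Defs where

open import Data.Nat using (ℕ; _+_; _*_; _∸_; _⊓_; _≤_)
open import Data.Fin using (Fin; toℕ)
open import Data.Bool using (Bool; true; false)
open import Data.List using (List; _∷_; []; concatMap; allFin)
open import Data.List.Relation.Unary.Unique.Propositional using (Unique)
open import Data.List.Membership.Propositional using (_∈_)
open import Data.Product using (Σ; ∃; _×_; _,_)
open import Relation.Binary.PropositionalEquality using (_≡_; _≢_)

record Star (g : ℕ) : Set where
  constructor star
  field
    centre : Fin g
    leaves : Fin 5 → Fin g
open Star public

starVertices : ∀ {g} → Star g → List (Fin g)
starVertices s = centre s ∷ Data.List.map (leaves s) (allFin 5)

-- The graph F is the union of the stars;
-- its edges are exactly {centre i , leaves i j}.
record AlmostStarFactor1 (g : ℕ) : Set where
  field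
    k        : ℕ
    stars    : Fin k → Star g
    isolated : Fin g
  vertexList : List (Fin g)
  vertexList = isolated ∷ concatMap (λ i → starVertices (stars i)) (allFin k)
  field
    disjoint : Unique vertexList
    covering : ∀ (v : Fin g) → v ∈ vertexList
open AlmostStarFactor1 public

Edge : ∀ {g} → AlmostStarFactor1 g → Set
Edge F = Fin (k F) × Fin 5

endpoints : ∀ {g} (F : AlmostStarFactor1 g) → Edge F → Fin g × Fin g
endpoints F (i , j) = centre (stars F i) , leaves (stars F i) j

dist : ∀ {g} (F : AlmostStarFactor1 g) → Edge F → ℕ
dist F e with endpoints F e
... | (a , b) = (toℕ a ∸ toℕ b) + (toℕ b ∸ toℕ a)

difference : ∀ {g} (F : AlmostStarFactor1 g) → Edge F → ℕ
difference {g} F e = dist F e ⊓ (g ∸ dist F e)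

IsForward : ∀ {g} (F : AlmostStarFactor1 g) → Edge F → Set
IsForward F e = difference F e ≡ dist F e

HasForwardDiff : ∀ {g} (F : AlmostStarFactor1 g) → Edge F → ℕ → Set
HasForwardDiff F e d = IsForward F e × dist F e ≡ d

-- pure/prime labelling (true = pure, false = prime)
Labelling : ∀ {g} → AlmostStarFactor1 g → Set
Labelling F = Edge F → Bool

IsPurePrimeLabelling : ∀ {g} (F : AlmostStarFactor1 g) → Labelling F → Set
IsPurePrimeLabelling F ℓ =
  ∀ (e e' : Edge F) → e ≢ e' → ℓ e ≡ ℓ e' → difference F e ≢ difference F e'

MixedStar : ∀ {g} (F : AlmostStarFactor1 g) → Labelling F → Fin (k F) → Set
MixedStar F ℓ i = Σ (Fin 5) λ j → Σ (Fin 5) λ j' → ℓ (i , j) ≡ true × ℓ (i , j') ≡ false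

{-# OPTIONS --safe #-}
module Submission where

-- For a star index i < n let ī = n − 1 − i; the "reaches" 2(i + 1) and 2ī + 1 enumerate 1, …, 2n
-- exactly once.  Write n = h + a with a ∈ {h, h + 1}.  Star i gets the centre 2n + h + 1 + i and
-- five leaves at differences 2(i + 1), 2ī + 1, n + 2(i + 1), n + 2ī + 1 and either 2n + 2(i + 1)
-- (if i < h) or 2n + 2ī + 1; leaves of even reach lie below the centre, those of odd reach above,
-- and together with the isolated vertex 2n + h they fill 0, …, 6n.  Every difference is at most
-- 3n, hence forward, and two edges of equal difference sit in consecutive blocks (offsets 0, n, 2n)
-- with reaches differing by exactly n.  For even n this pairs star i with star i + h, so "star i is
-- pure iff i < h" separates all collisions, and flipping the label of the edge of difference 2,
-- which no other edge shares, creates exactly one mixed star.  For odd n it pairs stars with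
-- i + i′ = h − 1 or i + i′ = 3h and exactly one of the two leaves is a middle one (offset n);
-- comparing 2i + 1 with h, resp. 2i with 3h, strictly at outer and weakly at middle leaves then
-- separates all collisions, and the only mixed star is the one paired with itself.

open import Defs
open import Data.Bool using (Bool; true; false; not; if_then_else_)
open import Data.Bool.Properties using (not-¬)
open import Data.Empty using (⊥-elim)
open import Data.Fin using (Fin; zero; suc; toℕ; fromℕ<; opposite) renaming (_≟_ to _≟ᶠ_)
open import Data.Fin.Patterns using (0F; 1F; 2F; 3F; 4F)
open import Data.Fin.Properties
  using (injective⇒≤; toℕ-fromℕ<; toℕ-injective; toℕ<n; opposite-prop; opposite-involutive)
open import Data.List using (List; []; _∷_; _++_; length; lookup; filter; concatMap; allFin)
open import Data.List.Membership.Propositional using (_∈_)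
open import Data.List.Membership.Propositional.Properties
  using (∈-lookup; ∈-filter⁺; ∈-filter⁻; ∈-allFin; ∈-concat⁺′; ∈-map⁺)
open import Data.List.Properties using (length-++; length-tabulate)
open import Data.List.Relation.Unary.All as All using (All)
import Data.List.Relation.Unary.AllPairs as AllPairs
open import Data.List.Relation.Unary.Any using (here; there; index)
open import Data.List.Relation.Unary.Any.Properties using (lookup-index)
open import Data.List.Relation.Unary.Unique.Propositional using (Unique)
open import Data.List.Relation.Unary.Unique.Propositional.Properties using (allFin⁺; filter⁺)
open import Data.Nat using (ℕ; zero; suc; _+_; _*_; _∸_; _≤_; _<_; _≤?_; _<?_; _≡ᵇ_; z≤n; s≤s; ⌊_/2⌋)
open import Data.Nat.Properties
open import Data.Nat.Tactic.RingSolver using (solve-∀; solve)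
open import Data.Product using (Σ; ∃; ∃₂; _×_; _,_; proj₁; proj₂)
open import Data.Product.Properties using (≡-dec)
open import Data.Sum using (_⊎_; inj₁; inj₂)
open import Function using (_∘_)
open import Relation.Binary.PropositionalEquality
open import Relation.Binary.Definitions using (DecidableEquality; Tri; tri<; tri≈; tri>)
open import Relation.Nullary using (¬_; Dec; yes; no; does; ¬?)
open import Relation.Nullary.Decidable using (dec-true; dec-false)

halve : ∀ n → ∃ λ h → n ≡ 2 * h ⊎ n ≡ suc (2 * h)
halve zero = 0 , inj₁ refl
halve (suc n) with halve n
... | h , inj₁ refl = h , inj₂ refl
... | h , inj₂ refl = suc h , inj₁ (cong suc (sym (+-suc h (h + 0))))

gap-down : ∀ {x y} d → x ≡ y + d → (x ∸ y) + (y ∸ x) ≡ d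
gap-down {y = y} d refl = trans (cong₂ _+_ (m+n∸m≡n y d) (m≤n⇒m∸n≡0 (m≤m+n y d))) (+-identityʳ d)

gap-up : ∀ {x y} d → y ≡ x + d → (x ∸ y) + (y ∸ x) ≡ d
gap-up {x = x} d refl = cong₂ _+_ (m≤n⇒m∸n≡0 (m≤m+n x d)) (m+n∸m≡n x d)

adjacent-offsets : ∀ {n b b′ r r′} → b * n + r ≡ b′ * n + r′ → b < b′ → r ≤ 2 * n → 1 ≤ r′ →
                   b′ ≡ suc b × r ≡ n + r′
adjacent-offsets {n} {b} {b′} {r} {r′} e b<b′ r≤2n 1≤r′ with b′ ∸ suc b | m+[n∸m]≡n b<b′
... | zero  | refl = cong suc (+-identityʳ b) , +-cancelˡ-≡ (b * n) r (n + r′) (begin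
  b * n + r              ≡⟨ e ⟩
  suc (b + 0) * n + r′   ≡⟨ solve (b ∷ n ∷ r′ ∷ []) ⟩
  b * n + (n + r′)       ∎)
  where open ≡-Reasoning
... | suc k | refl = ⊥-elim (<⇒≱ (m<m+n (2 * n) 0<rest) (subst (_≤ 2 * n) r≡ r≤2n))
  where
  open ≡-Reasoning
  0<rest : 0 < k * n + r′
  0<rest = ≤-trans 1≤r′ (m≤n+m r′ (k * n))
  r≡ : r ≡ 2 * n + (k * n + r′)
  r≡ = +-cancelˡ-≡ (b * n) r _ (begin
    b * n + r                        ≡⟨ e ⟩
    suc (b + suc k) * n + r′         ≡⟨ solve (b ∷ k ∷ n ∷ r′ ∷ []) ⟩
    b * n + (2 * n + (k * n + r′))   ∎)

below : Bool → ℕ → ℕ → Bool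
below true  x c = does (x ≤? c)
below false x c = does (x <? c)

below-complement : ∀ b {x y c} → x + y ≡ c + c → below b x c ≡ not (below (not b) y c)
below-complement true {x} {y} {c} sum = by-cases (x ≤? c) (y <? c)
  where
  by-cases : (x≤c? : Dec (x ≤ c)) (y<c? : Dec (y < c)) → does x≤c? ≡ not (does y<c?)
  by-cases (yes x≤c) (yes y<c) = ⊥-elim (<-irrefl sum (+-mono-≤-< x≤c y<c))
  by-cases (yes _)   (no _)    = refl
  by-cases (no _)    (yes _)   = refl
  by-cases (no x≰c)  (no y≮c)  = ⊥-elim (<-irrefl (sym sum) (+-mono-<-≤ (≰⇒> x≰c) (≮⇒≥ y≮c)))
below-complement false {x} {y} {c} sum = by-cases (x <? c) (y ≤? c)
  where
  by-cases : (x<c? : Dec (x < c)) (y≤c? : Dec (y ≤ c)) → does x<c? ≡ not (does y≤c?)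
  by-cases (yes x<c) (yes y≤c) = ⊥-elim (<-irrefl sum (+-mono-<-≤ x<c y≤c))
  by-cases (yes _)   (no _)    = refl
  by-cases (no _)    (yes _)   = refl
  by-cases (no x≮c)  (no y≰c)  = ⊥-elim (<-irrefl (sym sum) (+-mono-≤-< (≮⇒≥ x≮c) (≰⇒> y≰c)))

below-strictness : ∀ {x c} → below true x c ≢ below false x c → x ≡ c
below-strictness {x} {c} = by-cases (x ≤? c) (x <? c)
  where
  by-cases : (x≤c? : Dec (x ≤ c)) (x<c? : Dec (x < c)) → does x≤c? ≢ does x<c? → x ≡ c
  by-cases (yes x≤c) (no x≮c)  _      = ≤-antisym x≤c (≮⇒≥ x≮c)
  by-cases (yes _)   (yes _)   differ = ⊥-elim (differ refl)
  by-cases (no x≰c)  (yes x<c) _      = ⊥-elim (x≰c (<⇒≤ x<c))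
  by-cases (no _)    (no _)    differ = ⊥-elim (differ refl)

double-injective : ∀ {x y} → x + x ≡ y + y → x ≡ y
double-injective {x} {y} eq = trans (n≡⌊n+n/2⌋ x) (trans (cong ⌊_/2⌋ eq) (sym (n≡⌊n+n/2⌋ y)))

bool-pigeonhole : ∀ (x y z : Bool) → x ≡ y ⊎ x ≡ z ⊎ y ≡ z
bool-pigeonhole false false _     = inj₁ refl
bool-pigeonhole true  true  _     = inj₁ refl
bool-pigeonhole false true  false = inj₂ (inj₁ refl)
bool-pigeonhole true  false true  = inj₂ (inj₁ refl)
bool-pigeonhole false true  true  = inj₂ (inj₂ refl)
bool-pigeonhole true  false false = inj₂ (inj₂ refl)

true≢false : true ≢ false
true≢false ()

module _ {A : Set} where

  lookup-injective : ∀ {xs : List A} → Unique xs → ∀ p q → lookup xs p ≡ lookup xs q → p ≡ q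
  lookup-injective {_ ∷ _} (_ AllPairs.∷ _) 0F 0F _ = refl
  lookup-injective {_ ∷ _} (x∉ AllPairs.∷ _) 0F (suc q) eq = ⊥-elim (All.lookup x∉ (∈-lookup q) eq)
  lookup-injective {_ ∷ _} (x∉ AllPairs.∷ _) (suc p) 0F eq = ⊥-elim (All.lookup x∉ (∈-lookup p) (sym eq))
  lookup-injective {_ ∷ _} (_ AllPairs.∷ u) (suc p) (suc q) eq = cong suc (lookup-injective u p q eq)

  unique-⊆⇒length-≤ : ∀ {U xs : List A} → Unique U → (∀ {u} → u ∈ U → u ∈ xs) → length U ≤ length xs
  unique-⊆⇒length-≤ {U} {xs} uniq U⊆xs = injective⇒≤ {f = position} position-injective
    where
    position : Fin (length U) → Fin (length xs)
    position p = index (U⊆xs (∈-lookup p))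
    position-injective : ∀ {p q} → position p ≡ position q → p ≡ q
    position-injective {p} {q} eq = lookup-injective uniq p q (begin
      lookup U p                ≡⟨ lookup-index (U⊆xs (∈-lookup p)) ⟩
      lookup xs (position p)    ≡⟨ cong (lookup xs) eq ⟩
      lookup xs (position q)    ≡⟨ lookup-index (U⊆xs (∈-lookup q)) ⟨
      lookup U q                ∎)
      where open ≡-Reasoning

module _ {A : Set} (_≟_ : DecidableEquality A) where

  short-cover⇒unique : ∀ (xs : List A) {U} → Unique U → (∀ {u} → u ∈ U → u ∈ xs) →
                       length xs ≤ length U → Unique xs
  short-cover⇒unique []       _    _     _   = AllPairs.[]
  short-cover⇒unique (x ∷ xs) {U} uniq U⊆x∷xs len =
    All.tabulate x∉xs AllPairs.∷ short-cover⇒unique xs (filter⁺ ≢x? uniq) U-x⊆xs len′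
    where
    ≢x? : ∀ u → Dec (u ≢ x)
    ≢x? u = ¬? (u ≟ x)
    x∉xs : ∀ {y} → y ∈ xs → x ≢ y
    x∉xs {y} y∈xs refl = <⇒≱ len (unique-⊆⇒length-≤ uniq U⊆xs)
      where
      U⊆xs : ∀ {u} → u ∈ U → u ∈ xs
      U⊆xs u∈U with U⊆x∷xs u∈U
      ... | here refl = y∈xs
      ... | there u∈xs = u∈xs
    U-x⊆xs : ∀ {u} → u ∈ filter ≢x? U → u ∈ xs
    U-x⊆xs u∈ with ∈-filter⁻ ≢x? u∈
    ... | u∈U , u≢x with U⊆x∷xs u∈U
    ...   | here u≡x = ⊥-elim (u≢x u≡x)
    ...   | there u∈xs = u∈xs
    U⊆x∷U-x : ∀ {u} → u ∈ U → u ∈ x ∷ filter ≢x? U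
    U⊆x∷U-x {u} u∈U with u ≟ x
    ... | yes u≡x = here u≡x
    ... | no u≢x = there (∈-filter⁺ ≢x? u∈U u≢x)
    len′ : length xs ≤ length (filter ≢x? U)
    len′ = ≤-pred (≤-trans len (unique-⊆⇒length-≤ uniq U⊆x∷U-x))

covering⇒unique : ∀ {g} (xs : List (Fin g)) → length xs ≡ g → (∀ v → v ∈ xs) → Unique xs
covering⇒unique {g} xs len cover =
  short-cover⇒unique _≟ᶠ_ xs (allFin⁺ g) (λ {u} _ → cover u)
    (≤-reflexive (trans len (sym (length-tabulate {n = g} (λ v → v)))))

_≟ₑ_ : ∀ {k} → DecidableEquality (Fin k × Fin 5)
_≟ₑ_ = ≡-dec _≟ᶠ_ _≟ᶠ_

module _ {g k} (stars : Fin k → Star g) (isolated : Fin g) where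

  starVertices∈ : ∀ i {v} → v ∈ starVertices (stars i) →
                  v ∈ isolated ∷ concatMap (λ i → starVertices (stars i)) (allFin k)
  starVertices∈ i v∈ = there (∈-concat⁺′ v∈ (∈-map⁺ (λ i → starVertices (stars i)) (∈-allFin i)))

length-concatMap-starVertices : ∀ {g} {A : Set} (f : A → Star g) xs →
                                length (concatMap (λ x → starVertices (f x)) xs) ≡ 6 * length xs
length-concatMap-starVertices f [] = refl
length-concatMap-starVertices f (x ∷ xs) = begin
  length (starVertices (f x) ++ rest)   ≡⟨ length-++ (starVertices (f x)) {rest} ⟩
  6 + length rest                        ≡⟨ cong (6 +_) (length-concatMap-starVertices f xs) ⟩
  6 + 6 * length xs                      ≡⟨ *-distribˡ-+ 6 1 (length xs) ⟨
  6 * suc (length xs)                    ∎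
  where
  open ≡-Reasoning
  rest : List (Fin _)
  rest = concatMap (λ x → starVertices (f x)) xs

starFactor : ∀ {k} (stars : Fin k → Star (suc (6 * k))) (isolated : Fin (suc (6 * k))) →
             (∀ v → v ∈ isolated ∷ concatMap (λ i → starVertices (stars i)) (allFin k)) →
             AlmostStarFactor1 (suc (6 * k))
starFactor {k} stars isolated covers = record
  { k = k ; stars = stars ; isolated = isolated
  ; disjoint = covering⇒unique _ (cong suc length≡) covers ; covering = covers }
  where
  length≡ : length (concatMap (λ i → starVertices (stars i)) (allFin k)) ≡ 6 * k
  length≡ = trans (length-concatMap-starVertices stars (allFin k)) (cong (6 *_) (length-tabulate {n = k} (λ i → i)))

GoodFactor : ℕ → ℕ → Set
GoodFactor g D = Σ (AlmostStarFactor1 g) λ F →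
    ((d : ℕ) → 1 ≤ d → d ≤ D → Σ (Edge F) λ e → HasForwardDiff F e d)
    × ((d : ℕ) → 1 ≤ d → d ≤ D → (e₁ e₂ e₃ : Edge F) →
    e₁ ≢ e₂ → e₁ ≢ e₃ → e₂ ≢ e₃ →
    HasForwardDiff F e₁ d → HasForwardDiff F e₂ d → ¬ HasForwardDiff F e₃ d)
    × ((e : Edge F) → IsForward F e)
    × Σ (Labelling F) λ ℓ → IsPurePrimeLabelling F ℓ
    × Σ (Fin (k F)) λ i → MixedStar F ℓ i
    × ((i' : Fin (k F)) → MixedStar F ℓ i' → i' ≡ i)

module _ {g} (F : AlmostStarFactor1 g) where

  Separates : Labelling F → Set
  Separates ℓ = ∀ e e′ → dist F e ≡ dist F e′ → ℓ e ≡ ℓ e′ → e ≡ e′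

  short⇒forward : ∀ e → dist F e + dist F e ≤ g → IsForward F e
  short⇒forward e short = m≤n⇒m⊓n≡m (m+n≤o⇒m≤o∸n (dist F e) short)

  separates⇒pure-prime : ∀ {ℓ} → (∀ e → IsForward F e) → Separates ℓ → IsPurePrimeLabelling F ℓ
  separates⇒pure-prime forward sep e e′ e≢e′ same-label same-difference =
    e≢e′ (sep e e′ (trans (sym (forward e)) (trans same-difference (forward e′))) same-label)

  separates⇒at-most-two : ∀ {ℓ} → Separates ℓ → ∀ d (e₁ e₂ e₃ : Edge F) →
                          e₁ ≢ e₂ → e₁ ≢ e₃ → e₂ ≢ e₃ →
                          HasForwardDiff F e₁ d → HasForwardDiff F e₂ d → ¬ HasForwardDiff F e₃ d
  separates⇒at-most-two {ℓ} sep d e₁ e₂ e₃ e₁≢e₂ e₁≢e₃ e₂≢e₃ (_ , d₁) (_ , d₂) (_ , d₃)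
    with bool-pigeonhole (ℓ e₁) (ℓ e₂) (ℓ e₃)
  ... | inj₁ ℓ₁≡ℓ₂        = e₁≢e₂ (sep e₁ e₂ (trans d₁ (sym d₂)) ℓ₁≡ℓ₂)
  ... | inj₂ (inj₁ ℓ₁≡ℓ₃) = e₁≢e₃ (sep e₁ e₃ (trans d₁ (sym d₃)) ℓ₁≡ℓ₃)
  ... | inj₂ (inj₂ ℓ₂≡ℓ₃) = e₂≢e₃ (sep e₂ e₃ (trans d₂ (sym d₃)) ℓ₂≡ℓ₃)

  good-factor : ∀ {D ℓ} → (∀ e → IsForward F e) →
                (∀ d → 1 ≤ d → d ≤ D → Σ (Edge F) λ e → dist F e ≡ d) → Separates ℓ →
                ∀ i → MixedStar F ℓ i → (∀ i′ → MixedStar F ℓ i′ → i′ ≡ i) → GoodFactor g D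
  good-factor {D} {ℓ} forward onto sep i mixed only-mixed =
    F , realised , (λ d _ _ → separates⇒at-most-two sep d) , forward ,
    ℓ , separates⇒pure-prime forward sep , i , mixed , only-mixed
    where
    realised : ∀ d → 1 ≤ d → d ≤ D → Σ (Edge F) λ e → HasForwardDiff F e d
    realised d 1≤d d≤D with onto d 1≤d d≤D
    ... | e , dist≡d = e , forward e , dist≡d

  complementary⇒mixed : ∀ {ℓ : Labelling F} {i j j′} → ℓ (i , j) ≡ not (ℓ (i , j′)) → MixedStar F ℓ i
  complementary⇒mixed {ℓ} {i} {j} {j′} ℓj≡¬ℓj′ with ℓ (i , j′) in ℓj′≡
  ... | true  = j′ , j , ℓj′≡ , ℓj≡¬ℓj′
  ... | false = j , j′ , ℓj≡¬ℓj′ , ℓj′≡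

  flipAt : Edge F → Labelling F → Labelling F
  flipAt e₀ ℓ e = if does (e ≟ₑ e₀) then not (ℓ e) else ℓ e

  flipAt-here : ∀ e₀ ℓ → flipAt e₀ ℓ e₀ ≡ not (ℓ e₀)
  flipAt-here e₀ ℓ rewrite dec-true (e₀ ≟ₑ e₀) refl = refl

  flipAt-elsewhere : ∀ {e₀ e} ℓ → e ≢ e₀ → flipAt e₀ ℓ e ≡ ℓ e
  flipAt-elsewhere {e₀} {e} ℓ e≢e₀ rewrite dec-false (e ≟ₑ e₀) e≢e₀ = refl

  Lonely : Edge F → Set
  Lonely e₀ = ∀ e → dist F e ≡ dist F e₀ → e ≡ e₀

  flipAt-separates : ∀ {ℓ e₀} → Separates ℓ → Lonely e₀ → Separates (flipAt e₀ ℓ)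
  flipAt-separates {ℓ} {e₀} sep lonely e e′ same-dist same-label = by-cases (e ≟ₑ e₀) (e′ ≟ₑ e₀)
    where
    open ≡-Reasoning
    by-cases : Dec (e ≡ e₀) → Dec (e′ ≡ e₀) → e ≡ e′
    by-cases (yes e≡e₀) _          = trans e≡e₀ (sym (lonely e′ (trans (sym same-dist) (cong (dist F) e≡e₀))))
    by-cases (no _)     (yes e′≡e₀) = trans (lonely e (trans same-dist (cong (dist F) e′≡e₀))) (sym e′≡e₀)
    by-cases (no e≢e₀)  (no e′≢e₀)  = sep e e′ same-dist (begin
      ℓ e              ≡⟨ flipAt-elsewhere ℓ e≢e₀ ⟨
      flipAt e₀ ℓ e    ≡⟨ same-label ⟩
      flipAt e₀ ℓ e′   ≡⟨ flipAt-elsewhere ℓ e′≢e₀ ⟩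
      ℓ e′             ∎)

  StarConstant : Labelling F → Set
  StarConstant ℓ = ∀ i j j′ → ℓ (i , j) ≡ ℓ (i , j′)

  flipAt-mixes : ∀ {ℓ i₀ j₀ j₁} → StarConstant ℓ → j₁ ≢ j₀ → MixedStar F (flipAt (i₀ , j₀) ℓ) i₀
  flipAt-mixes {ℓ} {i₀} {j₀} {j₁} const j₁≢j₀ =
    complementary⇒mixed {ℓ = flipAt (i₀ , j₀) ℓ} {i₀} {j₀} {j₁} (begin
    flipAt (i₀ , j₀) ℓ (i₀ , j₀)   ≡⟨ flipAt-here (i₀ , j₀) ℓ ⟩
    not (ℓ (i₀ , j₀))              ≡⟨ cong not (const i₀ j₀ j₁) ⟩
    not (ℓ (i₀ , j₁))              ≡⟨ cong not (flipAt-elsewhere ℓ (j₁≢j₀ ∘ cong proj₂)) ⟨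
    not (flipAt (i₀ , j₀) ℓ (i₀ , j₁)) ∎)
    where open ≡-Reasoning

  flipAt-mixed⇒here : ∀ {ℓ i₀ j₀} → StarConstant ℓ →
                      ∀ i → MixedStar F (flipAt (i₀ , j₀) ℓ) i → i ≡ i₀
  flipAt-mixed⇒here {ℓ} {i₀} {j₀} const i (j , j′ , true≡ , false≡) = by-cases (i ≟ᶠ i₀)
    where
    open ≡-Reasoning
    by-cases : Dec (i ≡ i₀) → i ≡ i₀
    by-cases (yes i≡i₀) = i≡i₀
    by-cases (no i≢i₀)  = ⊥-elim (true≢false (begin
      true                            ≡⟨ true≡ ⟨
      flipAt (i₀ , j₀) ℓ (i , j)      ≡⟨ flipAt-elsewhere ℓ (i≢i₀ ∘ cong proj₁) ⟩
      ℓ (i , j)                       ≡⟨ const i j j′ ⟩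
      ℓ (i , j′)                      ≡⟨ flipAt-elsewhere ℓ (i≢i₀ ∘ cong proj₁) ⟨
      flipAt (i₀ , j₀) ℓ (i , j′)     ≡⟨ false≡ ⟩
      false                           ∎))

data Side : Set where
  left right : Side

outerSide : ∀ {P : Set} → Dec P → Side
outerSide (yes _) = left
outerSide (no _)  = right

block : Fin 5 → ℕ
block 0F = 0
block 1F = 0
block 2F = 1
block 3F = 1
block 4F = 2

block≤2 : ∀ j → block j ≤ 2
block≤2 0F = z≤n
block≤2 1F = z≤n
block≤2 2F = s≤s z≤n
block≤2 3F = s≤s z≤n
block≤2 4F = ≤-refl

isMiddle : Fin 5 → Bool
isMiddle j = block j ≡ᵇ 1

isMiddle-flips : ∀ {j j′} → block j′ ≡ suc (block j) → isMiddle j′ ≡ not (isMiddle j)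
isMiddle-flips {j} {j′} b′≡ = trans (cong (_≡ᵇ 1) b′≡) (flips (block j) (subst (_≤ 2) b′≡ (block≤2 j′)))
  where
  flips : ∀ b → suc b ≤ 2 → (suc b ≡ᵇ 1) ≡ not (b ≡ᵇ 1)
  flips 0             _ = refl
  flips 1             _ = refl
  flips (suc (suc _)) (s≤s (s≤s ()))

leafAt : ℕ → Side → Fin 5
leafAt 0             left  = 0F
leafAt 0             right = 1F
leafAt 1             left  = 2F
leafAt 1             right = 3F
leafAt (suc (suc _)) _     = 4F

module Construction (h a : ℕ) where

  n : ℕ
  n = h + a

  side : Fin n → Fin 5 → Side
  side _ 0F = left
  side _ 1F = right
  side _ 2F = left
  side _ 3F = right
  side i 4F = outerSide (toℕ i <? h)

  leafAt-block-side : ∀ i j → leafAt (block j) (side i j) ≡ j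
  leafAt-block-side i 0F = refl
  leafAt-block-side i 1F = refl
  leafAt-block-side i 2F = refl
  leafAt-block-side i 3F = refl
  leafAt-block-side i 4F = refl

  side-outer-left : ∀ {i} → toℕ i < h → side i 4F ≡ left
  side-outer-left {i} i<h with toℕ i <? h
  ... | yes _  = refl
  ... | no i≮h = ⊥-elim (i≮h i<h)

  side-outer-right : ∀ {i} → ¬ toℕ i < h → side i 4F ≡ right
  side-outer-right {i} i≮h with toℕ i <? h
  ... | yes i<h = ⊥-elim (i≮h i<h)
  ... | no _    = refl

  offset : Fin 5 → ℕ
  offset j = block j * n

  opposite-sum : ∀ i → suc (toℕ i + toℕ (opposite i)) ≡ n
  opposite-sum i = trans (cong (λ x → suc (toℕ i + x)) (opposite-prop i)) (m+[n∸m]≡n (toℕ<n i))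

  toℕ-opposite²-fromℕ< : ∀ {u} (u<n : u < n) → toℕ (opposite (opposite (fromℕ< u<n))) ≡ u
  toℕ-opposite²-fromℕ< u<n = trans (cong toℕ (opposite-involutive (fromℕ< u<n))) (toℕ-fromℕ< u<n)

  opposite<a⇒≮h : ∀ {i} → toℕ (opposite i) < a → ¬ toℕ i < h
  opposite<a⇒≮h {i} o<a i<h = <-irrefl (opposite-sum i) (begin-strict
    suc (toℕ i + toℕ (opposite i))         <⟨ n<1+n _ ⟩
    suc (suc (toℕ i + toℕ (opposite i)))   ≡⟨ cong suc (+-suc (toℕ i) (toℕ (opposite i))) ⟨
    suc (toℕ i) + suc (toℕ (opposite i))   ≤⟨ +-mono-≤ i<h o<a ⟩
    h + a                                  ∎)
    where open ≤-Reasoning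

  ≮h⇒opposite<a : ∀ {i} → ¬ toℕ i < h → toℕ (opposite i) < a
  ≮h⇒opposite<a {i} i≮h = +-cancelˡ-< h (toℕ (opposite i)) a (begin-strict
    h + toℕ (opposite i)      ≤⟨ +-monoˡ-≤ (toℕ (opposite i)) (≮⇒≥ i≮h) ⟩
    toℕ i + toℕ (opposite i)  <⟨ ≤-reflexive (opposite-sum i) ⟩
    h + a                     ∎)
    where open ≤-Reasoning

  reach : Side → Fin n → ℕ
  reach left  i = 2 * suc (toℕ i)
  reach right i = suc (2 * toℕ (opposite i))

  isolatedPos : ℕ
  isolatedPos = 2 * n + h

  centrePos : Fin n → ℕ
  centrePos i = suc (isolatedPos + toℕ i)

  leafPos : Side → ℕ → Fin n → ℕ
  leafPos left  o i = isolatedPos ∸ suc (o + toℕ i)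
  leafPos right o i = suc (isolatedPos + n + (o + toℕ (opposite i)))

  -- Keeps the truncated subtraction in leafPos left exact and every leaf position below 6n + 1.
  InRange : Side → ℕ → Fin n → Set
  InRange left  o i = o + toℕ i < 2 * n + h
  InRange right o i = o + toℕ (opposite i) < 2 * n + a

  inner-offset< : ∀ j {x} c → block j ≤ 1 → x < n → offset j + x < 2 * n + c
  inner-offset< j {x} c b≤1 x<n = begin-strict
    block j * n + x  <⟨ +-mono-≤-< (*-monoˡ-≤ n b≤1) x<n ⟩
    1 * n + n        ≡⟨ double n ⟩
    2 * n            ≤⟨ m≤m+n (2 * n) c ⟩
    2 * n + c        ∎
    where
    open ≤-Reasoning
    double : ∀ m → 1 * m + m ≡ 2 * m
    double = solve-∀

  inRange : ∀ i j → InRange (side i j) (offset j) i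
  inRange i 0F = inner-offset< 0F h z≤n (toℕ<n i)
  inRange i 1F = inner-offset< 1F a z≤n (toℕ<n (opposite i))
  inRange i 2F = inner-offset< 2F h ≤-refl (toℕ<n i)
  inRange i 3F = inner-offset< 3F a ≤-refl (toℕ<n (opposite i))
  inRange i 4F with toℕ i <? h
  ... | yes i<h = +-monoʳ-< (2 * n) i<h
  ... | no i≮h  = +-monoʳ-< (2 * n) (≮h⇒opposite<a i≮h)

  layout : isolatedPos + n + (2 * n + a) ≡ 6 * n
  layout = count h a
    where
    count : ∀ h a → 2 * (h + a) + h + (h + a) + (2 * (h + a) + a) ≡ 6 * (h + a)
    count = solve-∀

  centres≤6n : isolatedPos + n ≤ 6 * n
  centres≤6n = subst (isolatedPos + n ≤_) layout (m≤m+n (isolatedPos + n) (2 * n + a))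

  isolatedPos≤ : isolatedPos ≤ 6 * n
  isolatedPos≤ = ≤-trans (m≤m+n isolatedPos n) centres≤6n

  centrePos≤ : ∀ i → centrePos i ≤ 6 * n
  centrePos≤ i = ≤-trans (+-monoʳ-< isolatedPos (toℕ<n i)) centres≤6n

  leafPos≤ : ∀ s {o i} → InRange s o i → leafPos s o i ≤ 6 * n
  leafPos≤ left  {o} {i} _ = ≤-trans (m∸n≤m isolatedPos (suc (o + toℕ i))) isolatedPos≤
  leafPos≤ right o+ō< = ≤-trans (+-monoʳ-< (isolatedPos + n) o+ō<) (≤-reflexive layout)

  Vertex : Set
  Vertex = Fin (suc (6 * n))

  vertex : (x : ℕ) → x ≤ 6 * n → Vertex
  vertex x x≤6n = fromℕ< (s≤s x≤6n)

  centreVertex : Fin n → Vertex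
  centreVertex i = vertex (centrePos i) (centrePos≤ i)

  leafVertex : Fin n → Fin 5 → Vertex
  leafVertex i j = vertex (leafPos (side i j) (offset j) i) (leafPos≤ (side i j) (inRange i j))

  isolatedVertex : Vertex
  isolatedVertex = vertex isolatedPos isolatedPos≤

  fiveStar : Fin n → Star (suc (6 * n))
  fiveStar i = star (centreVertex i) (leafVertex i)

  vertices : List Vertex
  vertices = isolatedVertex ∷ concatMap (λ i → starVertices (fiveStar i)) (allFin n)

  toℕ-vertex : ∀ {x} (x≤6n : x ≤ 6 * n) → toℕ (vertex x x≤6n) ≡ x
  toℕ-vertex x≤6n = toℕ-fromℕ< (s≤s x≤6n)

  vertex≡ : ∀ {x} (x≤6n : x ≤ 6 * n) v → x ≡ toℕ v → vertex x x≤6n ≡ v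
  vertex≡ x≤6n v x≡ = toℕ-injective (trans (toℕ-vertex x≤6n) x≡)

  data OffsetView (c : ℕ) : ℕ → Set where
    inner  : ∀ {u} → u < n → OffsetView c (0 * n + u)
    middle : ∀ {u} → u < n → OffsetView c (1 * n + u)
    outer  : ∀ {u} → u < c → OffsetView c (2 * n + u)

  offsetView : ∀ c {t} → t < 2 * n + c → OffsetView c t
  offsetView c {t} t< with t <? n | t <? 2 * n
  ... | yes t<n | _        = inner t<n
  ... | no t≮n  | yes t<2n with t ∸ n | m+[n∸m]≡n (≮⇒≥ t≮n)
  ...   | u | refl = subst (OffsetView c) (cong (_+ u) (*-identityˡ n))
                       (middle (+-cancelˡ-< n u n (subst (n + u <_) (cong (n +_) (+-identityʳ n)) t<2n)))
  offsetView c {t} t< | no _ | no t≮2n with t ∸ 2 * n | m+[n∸m]≡n (≮⇒≥ t≮2n)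
  ...   | u | refl = outer (+-cancelˡ-< (2 * n) u c t<)

  left-leaf-onto : ∀ {t} → t < 2 * n + h → ∃₂ λ i j → side i j ≡ left × offset j + toℕ i ≡ t
  left-leaf-onto t< = by-offset (offsetView h t<)
    where
    by-offset : ∀ {t} → OffsetView h t → ∃₂ λ i j → side i j ≡ left × offset j + toℕ i ≡ t
    by-offset (inner u<n)  = fromℕ< u<n , 0F , refl , toℕ-fromℕ< u<n
    by-offset (middle u<n) = fromℕ< u<n , 2F , refl , cong (1 * n +_) (toℕ-fromℕ< u<n)
    by-offset (outer {u} u<h) =
      fromℕ< u<n , 4F , side-outer-left (subst (_< h) (sym (toℕ-fromℕ< u<n)) u<h) , cong (2 * n +_) (toℕ-fromℕ< u<n)
      where
      u<n : u < n
      u<n = ≤-trans u<h (m≤m+n h a)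

  right-leaf-onto : ∀ {t} → t < 2 * n + a → ∃₂ λ i j → side i j ≡ right × offset j + toℕ (opposite i) ≡ t
  right-leaf-onto t< = by-offset (offsetView a t<)
    where
    by-offset : ∀ {t} → OffsetView a t → ∃₂ λ i j → side i j ≡ right × offset j + toℕ (opposite i) ≡ t
    by-offset (inner u<n)  = opposite (fromℕ< u<n) , 1F , refl , toℕ-opposite²-fromℕ< u<n
    by-offset (middle u<n) = opposite (fromℕ< u<n) , 3F , refl , cong (1 * n +_) (toℕ-opposite²-fromℕ< u<n)
    by-offset (outer {u} u<a) =
      opposite (fromℕ< u<n) , 4F ,
      side-outer-right (opposite<a⇒≮h (subst (_< a) (sym (toℕ-opposite²-fromℕ< u<n)) u<a)) ,
      cong (2 * n +_) (toℕ-opposite²-fromℕ< u<n)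
      where
      u<n : u < n
      u<n = ≤-trans u<a (m≤n+m a h)

  leaf∈ : ∀ {v} i j → leafPos (side i j) (offset j) i ≡ toℕ v → v ∈ vertices
  leaf∈ {v} i j pos≡ = subst (_∈ vertices) (vertex≡ (leafPos≤ (side i j) (inRange i j)) v pos≡)
                     (starVertices∈ fiveStar isolatedVertex i (there (∈-map⁺ (leafVertex i) (∈-allFin j))))

  below-isolated∈ : ∀ v → toℕ v < isolatedPos → v ∈ vertices
  below-isolated∈ v x<p = from-leaf (left-leaf-onto t<)
    where
    open ≡-Reasoning
    t : ℕ
    t = isolatedPos ∸ suc (toℕ v)
    p≡ : isolatedPos ≡ suc (toℕ v + t)
    p≡ = sym (m+[n∸m]≡n x<p)
    t< : t < 2 * n + h
    t< = subst (t <_) (sym p≡) (s≤s (m≤n+m t (toℕ v)))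
    from-leaf : (∃₂ λ i j → side i j ≡ left × offset j + toℕ i ≡ t) → v ∈ vertices
    from-leaf (i , j , side≡ , pos≡) = leaf∈ i j (begin
      leafPos (side i j) (offset j) i        ≡⟨ cong (λ s → leafPos s (offset j) i) side≡ ⟩
      isolatedPos ∸ suc (offset j + toℕ i)   ≡⟨ cong (λ y → isolatedPos ∸ suc y) pos≡ ⟩
      isolatedPos ∸ suc t                    ≡⟨ cong (_∸ suc t) p≡ ⟩
      suc (toℕ v + t) ∸ suc t                ≡⟨ m+n∸n≡m (toℕ v) t ⟩
      toℕ v                                  ∎)

  centre∈ : ∀ v → isolatedPos < toℕ v → toℕ v ≤ isolatedPos + n → v ∈ vertices
  centre∈ v p<x x≤p+n = subst (_∈ vertices) (vertex≡ (centrePos≤ i) v centre≡)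
                          (starVertices∈ fiveStar isolatedVertex i (here refl))
    where
    u : ℕ
    u = toℕ v ∸ suc isolatedPos
    x≡ : suc (isolatedPos + u) ≡ toℕ v
    x≡ = m+[n∸m]≡n p<x
    u<n : u < n
    u<n = +-cancelˡ-< isolatedPos u n (subst (_≤ isolatedPos + n) (sym x≡) x≤p+n)
    i : Fin n
    i = fromℕ< u<n
    centre≡ : centrePos i ≡ toℕ v
    centre≡ = trans (cong (λ x → suc (isolatedPos + x)) (toℕ-fromℕ< u<n)) x≡

  above-centres∈ : ∀ v → isolatedPos + n < toℕ v → v ∈ vertices
  above-centres∈ v q<x = from-leaf (right-leaf-onto t<)
    where
    q : ℕ
    q = isolatedPos + n
    t : ℕ
    t = toℕ v ∸ suc q
    x≡ : suc (q + t) ≡ toℕ v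
    x≡ = m+[n∸m]≡n q<x
    t< : t < 2 * n + a
    t< = +-cancelˡ-< q t (2 * n + a) (begin-strict
      q + t               <⟨ ≤-reflexive x≡ ⟩
      toℕ v               ≤⟨ ≤-pred (toℕ<n v) ⟩
      6 * n               ≡⟨ layout ⟨
      q + (2 * n + a)     ∎)
      where open ≤-Reasoning
    from-leaf : (∃₂ λ i j → side i j ≡ right × offset j + toℕ (opposite i) ≡ t) → v ∈ vertices
    from-leaf (i , j , side≡ , pos≡) = leaf∈ i j (begin
      leafPos (side i j) (offset j) i                  ≡⟨ cong (λ s → leafPos s (offset j) i) side≡ ⟩
      suc (q + (offset j + toℕ (opposite i)))          ≡⟨ cong (λ y → suc (q + y)) pos≡ ⟩
      suc (q + t)                                      ≡⟨ x≡ ⟩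
      toℕ v                                            ∎)
      where open ≡-Reasoning

  covers : ∀ v → v ∈ vertices
  covers v = by-position (<-cmp (toℕ v) isolatedPos) (toℕ v ≤? isolatedPos + n)
    where
    by-position : Tri (toℕ v < isolatedPos) (toℕ v ≡ isolatedPos) (isolatedPos < toℕ v) →
                  Dec (toℕ v ≤ isolatedPos + n) → v ∈ vertices
    by-position (tri< x<p _ _) _             = below-isolated∈ v x<p
    by-position (tri≈ _ x≡p _) _             = here (sym (vertex≡ isolatedPos≤ v (sym x≡p)))
    by-position (tri> _ _ p<x) (yes x≤p+n)   = centre∈ v p<x x≤p+n
    by-position (tri> _ _ _)   (no x≰p+n)    = above-centres∈ v (≰⇒> x≰p+n)

  factor : AlmostStarFactor1 (suc (6 * n))
  factor = starFactor fiveStar isolatedVertex covers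

  reach-gap : ∀ s {o i} → InRange s o i →
              (centrePos i ∸ leafPos s o i) + (leafPos s o i ∸ centrePos i) ≡ o + reach s i
  reach-gap left {o} {i} o+i< = gap-down {centrePos i} {leafPos left o i} (o + reach left i) (begin
    suc (isolatedPos + toℕ i)            ≡⟨ cong (λ p → suc (p + toℕ i)) p≡ ⟨
    suc (suc (o + toℕ i) + t + toℕ i)    ≡⟨ rearrange o (toℕ i) t ⟩
    t + (o + 2 * suc (toℕ i))            ∎)
    where
    open ≡-Reasoning
    rearrange : ∀ o i t → suc (suc (o + i) + t + i) ≡ t + (o + 2 * suc i)
    rearrange = solve-∀
    t : ℕ
    t = isolatedPos ∸ suc (o + toℕ i)
    p≡ : suc (o + toℕ i) + t ≡ isolatedPos
    p≡ = m+[n∸m]≡n o+i<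
  reach-gap right {o} {i} _ = gap-up {centrePos i} {leafPos right o i} (o + reach right i) (begin
    suc (isolatedPos + n + (o + ō))                    ≡⟨ cong (λ m → suc (isolatedPos + m + (o + ō))) (opposite-sum i) ⟨
    suc (isolatedPos + suc (toℕ i + ō) + (o + ō))      ≡⟨ rearrange isolatedPos (toℕ i) ō o ⟩
    suc (isolatedPos + toℕ i) + (o + suc (2 * ō))      ∎)
    where
    open ≡-Reasoning
    rearrange : ∀ p i ō o → suc (p + suc (i + ō) + (o + ō)) ≡ suc (p + i) + (o + suc (2 * ō))
    rearrange = solve-∀
    ō : ℕ
    ō = toℕ (opposite i)

  dist≡ : ∀ i j → dist factor (i , j) ≡ offset j + reach (side i j) i
  dist≡ i j = begin
    (toℕ (centreVertex i) ∸ toℕ (leafVertex i j)) + (toℕ (leafVertex i j) ∸ toℕ (centreVertex i))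
      ≡⟨ cong₂ (λ x y → (x ∸ y) + (y ∸ x))
           (toℕ-vertex (centrePos≤ i)) (toℕ-vertex (leafPos≤ (side i j) (inRange i j))) ⟩
    (centrePos i ∸ leafPos (side i j) (offset j) i) + (leafPos (side i j) (offset j) i ∸ centrePos i)
      ≡⟨ reach-gap (side i j) (inRange i j) ⟩
    offset j + reach (side i j) i
      ∎
    where open ≡-Reasoning

  reach-positive : ∀ s i → 1 ≤ reach s i
  reach-positive left  _ = s≤s z≤n
  reach-positive right _ = s≤s z≤n

  reach≤2n : ∀ s i → reach s i ≤ 2 * n
  reach≤2n left  i = *-monoʳ-≤ 2 (toℕ<n i)
  reach≤2n right i = begin
    suc (2 * ō)         ≤⟨ n≤1+n _ ⟩
    suc (suc (2 * ō))   ≡⟨ *-distribˡ-+ 2 1 ō ⟨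
    2 * suc ō           ≤⟨ *-monoʳ-≤ 2 (toℕ<n (opposite i)) ⟩
    2 * n               ∎
    where
    open ≤-Reasoning
    ō : ℕ
    ō = toℕ (opposite i)

  reach-injective : ∀ {s s′ i i′} → reach s i ≡ reach s′ i′ → s ≡ s′ × i ≡ i′
  reach-injective {left}  {left}  {i} {i′} eq =
    refl , toℕ-injective (suc-injective (*-cancelˡ-≡ (suc (toℕ i)) (suc (toℕ i′)) 2 eq))
  reach-injective {right} {right} {i} {i′} eq = refl , (begin
    i                        ≡⟨ opposite-involutive i ⟨
    opposite (opposite i)    ≡⟨ cong opposite opposite≡ ⟩
    opposite (opposite i′)   ≡⟨ opposite-involutive i′ ⟩
    i′                       ∎)
    where
    open ≡-Reasoning
    opposite≡ : opposite i ≡ opposite i′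
    opposite≡ = toℕ-injective (*-cancelˡ-≡ (toℕ (opposite i)) (toℕ (opposite i′)) 2 (suc-injective eq))
  reach-injective {left}  {right} {i} {i′} eq = ⊥-elim (even≢odd (suc (toℕ i)) (toℕ (opposite i′)) eq)
  reach-injective {right} {left}  {i} {i′} eq = ⊥-elim (even≢odd (suc (toℕ i′)) (toℕ (opposite i)) (sym eq))

  same-block⇒same-edge : ∀ i j i′ j′ → block j ≡ block j′ → dist factor (i , j) ≡ dist factor (i′ , j′) →
                         (i , j) ≡ (i′ , j′)
  same-block⇒same-edge i j i′ j′ b≡ d≡ = conclude (reach-injective {side i j} {side i′ j′} {i} {i′} reach≡)
    where
    open ≡-Reasoning
    reach≡ : reach (side i j) i ≡ reach (side i′ j′) i′
    reach≡ = +-cancelˡ-≡ (offset j) _ _ (begin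
      offset j + reach (side i j) i       ≡⟨ dist≡ i j ⟨
      dist factor (i , j)                 ≡⟨ d≡ ⟩
      dist factor (i′ , j′)               ≡⟨ dist≡ i′ j′ ⟩
      offset j′ + reach (side i′ j′) i′   ≡⟨ cong (λ b → b * n + reach (side i′ j′) i′) b≡ ⟨
      offset j + reach (side i′ j′) i′    ∎)
    conclude : side i j ≡ side i′ j′ × i ≡ i′ → (i , j) ≡ (i′ , j′)
    conclude (side≡ , i≡i′) = cong₂ _,_ i≡i′ (begin
      j                                ≡⟨ leafAt-block-side i j ⟨
      leafAt (block j) (side i j)      ≡⟨ cong₂ leafAt b≡ side≡ ⟩
      leafAt (block j′) (side i′ j′)   ≡⟨ leafAt-block-side i′ j′ ⟩
      j′                               ∎)

  Adjacent : Edge factor → Edge factor → Set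
  Adjacent (i , j) (i′ , j′) = block j′ ≡ suc (block j) × reach (side i j) i ≡ n + reach (side i′ j′) i′

  collision : ∀ e e′ → e ≢ e′ → dist factor e ≡ dist factor e′ → Adjacent e e′ ⊎ Adjacent e′ e
  collision (i , j) (i′ , j′) e≢e′ d≡ = by-blocks (<-cmp (block j) (block j′))
    where
    offsets≡ : offset j + reach (side i j) i ≡ offset j′ + reach (side i′ j′) i′
    offsets≡ = trans (sym (dist≡ i j)) (trans d≡ (dist≡ i′ j′))
    by-blocks : Tri (block j < block j′) (block j ≡ block j′) (block j′ < block j) →
                Adjacent (i , j) (i′ , j′) ⊎ Adjacent (i′ , j′) (i , j)
    by-blocks (tri< b<b′ _ _) =
      inj₁ (adjacent-offsets offsets≡ b<b′ (reach≤2n (side i j) i) (reach-positive (side i′ j′) i′))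
    by-blocks (tri≈ _ b≡b′ _) = ⊥-elim (e≢e′ (same-block⇒same-edge i j i′ j′ b≡b′ d≡))
    by-blocks (tri> _ _ b′<b) =
      inj₂ (adjacent-offsets (sym offsets≡) b′<b (reach≤2n (side i′ j′) i′) (reach-positive (side i j) i))

  adjacent⇒far : ∀ {e e′} → Adjacent e e′ → n < dist factor e′
  adjacent⇒far {i , j} {i′ , j′} (b′≡ , _) = begin-strict
    n                               <⟨ m<m+n n (reach-positive (side i′ j′) i′) ⟩
    n + R′                          ≤⟨ +-monoˡ-≤ R′ (m≤m+n n (block j * n)) ⟩
    suc (block j) * n + R′          ≡⟨ cong (λ b → b * n + R′) b′≡ ⟨
    offset j′ + R′                  ≡⟨ dist≡ i′ j′ ⟨
    dist factor (i′ , j′)           ∎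
    where
    open ≤-Reasoning
    R′ : ℕ
    R′ = reach (side i′ j′) i′

  adjacent-apart⇒separates : ∀ {ℓ} → (∀ e e′ → Adjacent e e′ → ℓ e ≢ ℓ e′) → Separates factor ℓ
  adjacent-apart⇒separates {ℓ} apart e e′ d≡ ℓ≡ = by-cases (e ≟ₑ e′)
    where
    by-cases : Dec (e ≡ e′) → e ≡ e′
    by-cases (yes e≡e′) = e≡e′
    by-cases (no e≢e′) with collision e e′ e≢e′ d≡
    ... | inj₁ adjacent = ⊥-elim (apart e e′ adjacent ℓ≡)
    ... | inj₂ adjacent = ⊥-elim (apart e′ e adjacent (sym ℓ≡))

  reach-onto : ∀ {d} → 1 ≤ d → d ≤ 2 * n → ∃₂ λ s i → reach s i ≡ d
  reach-onto {d} 1≤d d≤2n = by-parity (halve d)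
    where
    by-parity : (∃ λ t → d ≡ 2 * t ⊎ d ≡ suc (2 * t)) → ∃₂ λ s i → reach s i ≡ d
    by-parity (zero , inj₁ d≡0) = ⊥-elim (<⇒≱ 1≤d (≤-reflexive d≡0))
    by-parity (suc t , inj₁ d≡) = left , fromℕ< t<n , trans (cong (λ x → 2 * suc x) (toℕ-fromℕ< t<n)) (sym d≡)
      where
      t<n : t < n
      t<n = *-cancelˡ-≤ 2 (subst (_≤ 2 * n) d≡ d≤2n)
    by-parity (t , inj₂ d≡) =
      right , opposite (fromℕ< t<n) , trans (cong (λ x → suc (2 * x)) (toℕ-opposite²-fromℕ< t<n)) (sym d≡)
      where
      t<n : t < n
      t<n = *-cancelˡ-< 2 t n (<-≤-trans (n<1+n (2 * t)) (subst (_≤ 2 * n) d≡ d≤2n))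

  dist-leafAt : ∀ b s i → b ≤ 1 → dist factor (i , leafAt b s) ≡ b * n + reach s i
  dist-leafAt 0             left  i _ = dist≡ i 0F
  dist-leafAt 0             right i _ = dist≡ i 1F
  dist-leafAt 1             left  i _ = dist≡ i 2F
  dist-leafAt 1             right i _ = dist≡ i 3F
  dist-leafAt (suc (suc _)) _     _ (s≤s ())

  dist-onto : ∀ d → 1 ≤ d → d ≤ 3 * n → Σ (Edge factor) λ e → dist factor e ≡ d
  dist-onto d 1≤d d≤3n = by-size (d ≤? 2 * n)
    where
    inner-edge : (∃₂ λ s i → reach s i ≡ d) → Σ (Edge factor) λ e → dist factor e ≡ d
    inner-edge (s , i , reach≡d) = (i , leafAt 0 s) , trans (dist-leafAt 0 s i z≤n) reach≡d
    middle-edge : n < d → (∃₂ λ s i → reach s i ≡ d ∸ n) → Σ (Edge factor) λ e → dist factor e ≡ d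
    middle-edge n<d (s , i , reach≡) = (i , leafAt 1 s) , (begin
      dist factor (i , leafAt 1 s)   ≡⟨ dist-leafAt 1 s i ≤-refl ⟩
      1 * n + reach s i              ≡⟨ cong₂ _+_ (*-identityˡ n) reach≡ ⟩
      n + (d ∸ n)                    ≡⟨ m+[n∸m]≡n (<⇒≤ n<d) ⟩
      d                              ∎)
      where open ≡-Reasoning
    by-size : Dec (d ≤ 2 * n) → Σ (Edge factor) λ e → dist factor e ≡ d
    by-size (yes d≤2n) = inner-edge (reach-onto 1≤d d≤2n)
    by-size (no d≰2n)  = middle-edge n<d (reach-onto (m<n⇒0<n∸m n<d) d∸n≤2n)
      where
      n<d : n < d
      n<d = ≤-<-trans (m≤m+n n (n + 0)) (≰⇒> d≰2n)
      d∸n≤2n : d ∸ n ≤ 2 * n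
      d∸n≤2n = subst (d ∸ n ≤_) (m+n∸m≡n n (2 * n)) (∸-monoˡ-≤ n d≤3n)

  outer-reach≤n : h ≤ a → a ≤ suc h → ∀ i → reach (side i 4F) i ≤ n
  outer-reach≤n h≤a a≤1+h i = by-side (toℕ i <? h)
    where
    open ≤-Reasoning
    by-side : (i<h? : Dec (toℕ i < h)) → reach (outerSide i<h?) i ≤ n
    by-side (yes i<h) = begin
      2 * suc (toℕ i)   ≤⟨ *-monoʳ-≤ 2 i<h ⟩
      2 * h             ≡⟨ cong (h +_) (+-identityʳ h) ⟩
      h + h             ≤⟨ +-monoʳ-≤ h h≤a ⟩
      h + a             ∎
    by-side (no i≮h) = begin
      suc ō + (ō + 0)   ≤⟨ +-mono-≤ ō<a (≤-trans (≤-reflexive (+-identityʳ ō)) ō≤h) ⟩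
      a + h             ≡⟨ +-comm a h ⟩
      h + a             ∎
      where
      ō : ℕ
      ō = toℕ (opposite i)
      ō<a : ō < a
      ō<a = ≮h⇒opposite<a i≮h
      ō≤h : ō ≤ h
      ō≤h = ≤-pred (≤-trans ō<a a≤1+h)

  inner-dist≤3n : ∀ i j → block j ≤ 1 → dist factor (i , j) ≤ 3 * n
  inner-dist≤3n i j b≤1 = begin
    dist factor (i , j)               ≡⟨ dist≡ i j ⟩
    block j * n + reach (side i j) i  ≤⟨ +-mono-≤ (*-monoˡ-≤ n b≤1) (reach≤2n (side i j) i) ⟩
    1 * n + 2 * n                     ≡⟨ cong (_+ 2 * n) (*-identityˡ n) ⟩
    3 * n                             ∎
    where open ≤-Reasoning

  dist≤3n : h ≤ a → a ≤ suc h → ∀ e → dist factor e ≤ 3 * n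
  dist≤3n _ _ (i , 0F) = inner-dist≤3n i 0F z≤n
  dist≤3n _ _ (i , 1F) = inner-dist≤3n i 1F z≤n
  dist≤3n _ _ (i , 2F) = inner-dist≤3n i 2F ≤-refl
  dist≤3n _ _ (i , 3F) = inner-dist≤3n i 3F ≤-refl
  dist≤3n h≤a a≤1+h (i , 4F) = begin
    dist factor (i , 4F)               ≡⟨ dist≡ i 4F ⟩
    2 * n + reach (side i 4F) i        ≤⟨ +-monoʳ-≤ (2 * n) (outer-reach≤n h≤a a≤1+h i) ⟩
    2 * n + n                          ≡⟨ +-comm (2 * n) n ⟩
    3 * n                              ∎
    where open ≤-Reasoning

  forward : h ≤ a → a ≤ suc h → ∀ e → IsForward factor e
  forward h≤a a≤1+h e = short⇒forward factor e (begin
    dist factor e + dist factor e   ≤⟨ +-mono-≤ (dist≤3n h≤a a≤1+h e) (dist≤3n h≤a a≤1+h e) ⟩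
    3 * n + 3 * n                   ≡⟨ *-distribʳ-+ n 3 3 ⟨
    6 * n                           ≤⟨ n≤1+n (6 * n) ⟩
    suc (6 * n)                     ∎)
    where open ≤-Reasoning

  separated⇒good : h ≤ a → a ≤ suc h → ∀ {ℓ} → Separates factor ℓ →
                      ∀ i → MixedStar factor ℓ i → (∀ i′ → MixedStar factor ℓ i′ → i′ ≡ i) →
                      GoodFactor (suc (6 * n)) (3 * n)
  separated⇒good h≤a a≤1+h = good-factor factor (forward h≤a a≤1+h) dist-onto

module EvenCase (h : ℕ) (1≤h : 1 ≤ h) where

  open Construction h h

  colour : Labelling factor
  colour (i , _) = does (toℕ i <? h)

  shift-by-half : ∀ {s s′ i i′} → reach s i ≡ n + reach s′ i′ →
                  toℕ i ≡ h + toℕ i′ ⊎ toℕ i′ ≡ h + toℕ i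
  shift-by-half {left} {left} {i} {i′} eq = inj₁ (suc-injective (begin
    suc (toℕ i)         ≡⟨ *-cancelˡ-≡ (suc (toℕ i)) (h + suc (toℕ i′)) 2 (trans eq (rearrange h (toℕ i′))) ⟩
    h + suc (toℕ i′)    ≡⟨ +-suc h (toℕ i′) ⟩
    suc (h + toℕ i′)    ∎))
    where
    open ≡-Reasoning
    rearrange : ∀ h x → h + h + 2 * suc x ≡ 2 * (h + suc x)
    rearrange = solve-∀
  shift-by-half {right} {right} {i} {i′} eq = inj₂ (+-cancelʳ-≡ ō′ (toℕ i′) (h + toℕ i) (begin
    toℕ i′ + ō′           ≡⟨ suc-injective (trans (opposite-sum i′) (sym (opposite-sum i))) ⟩
    toℕ i + ō             ≡⟨ cong (toℕ i +_) ō≡ ⟩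
    toℕ i + (h + ō′)      ≡⟨ +-assoc (toℕ i) h ō′ ⟨
    toℕ i + h + ō′        ≡⟨ cong (_+ ō′) (+-comm (toℕ i) h) ⟩
    h + toℕ i + ō′        ∎))
    where
    open ≡-Reasoning
    ō ō′ : ℕ
    ō = toℕ (opposite i)
    ō′ = toℕ (opposite i′)
    rearrange : ∀ h x → h + h + suc (2 * x) ≡ suc (2 * (h + x))
    rearrange = solve-∀
    ō≡ : ō ≡ h + ō′
    ō≡ = *-cancelˡ-≡ ō (h + ō′) 2 (suc-injective (trans eq (rearrange h ō′)))
  shift-by-half {left} {right} {i} {i′} eq =
    ⊥-elim (even≢odd (suc (toℕ i)) (h + toℕ (opposite i′)) (trans eq (rearrange h (toℕ (opposite i′)))))
    where
    rearrange : ∀ h x → h + h + suc (2 * x) ≡ suc (2 * (h + x))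
    rearrange = solve-∀
  shift-by-half {right} {left} {i} {i′} eq =
    ⊥-elim (even≢odd (h + suc (toℕ i′)) (toℕ (opposite i)) (sym (trans eq (rearrange h (toℕ i′)))))
    where
    rearrange : ∀ h x → h + h + 2 * suc x ≡ 2 * (h + suc x)
    rearrange = solve-∀

  shifted-colours : ∀ {x y} → x ≡ h + y → x < n → does (x <? h) ≢ does (y <? h)
  shifted-colours {x} {y} x≡ x<n same = true≢false (begin
    true             ≡⟨ dec-true (y <? h) y<h ⟨
    does (y <? h)    ≡⟨ same ⟨
    does (x <? h)    ≡⟨ dec-false (x <? h) x≮h ⟩
    false            ∎)
    where
    open ≡-Reasoning
    x≮h : ¬ x < h
    x≮h x<h = <⇒≱ x<h (subst (h ≤_) (sym x≡) (m≤m+n h y))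
    y<h : y < h
    y<h = +-cancelˡ-< h y h (subst (_< h + h) x≡ x<n)

  colours-apart : ∀ e e′ → Adjacent e e′ → colour e ≢ colour e′
  colours-apart (i , j) (i′ , j′) (_ , reach≡) with shift-by-half {side i j} {side i′ j′} {i} {i′} reach≡
  ... | inj₁ i≡ = shifted-colours i≡ (toℕ<n i)
  ... | inj₂ i′≡ = shifted-colours i′≡ (toℕ<n i′) ∘ sym

  0<n : 0 < n
  0<n = ≤-trans 1≤h (m≤m+n h h)

  firstLeaf : Edge factor
  firstLeaf = fromℕ< 0<n , 0F

  firstLeaf-lonely : Lonely factor firstLeaf
  firstLeaf-lonely e d≡ = by-cases (e ≟ₑ firstLeaf)
    where
    dist-firstLeaf≤n : dist factor firstLeaf ≤ n
    dist-firstLeaf≤n = begin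
      dist factor firstLeaf                 ≡⟨ dist≡ (fromℕ< 0<n) 0F ⟩
      2 * suc (toℕ (fromℕ< 0<n))            ≡⟨ cong (λ x → 2 * suc x) (toℕ-fromℕ< 0<n) ⟩
      2 * 1                                 ≤⟨ *-monoʳ-≤ 2 1≤h ⟩
      2 * h                                 ≡⟨ cong (h +_) (+-identityʳ h) ⟩
      n                                     ∎
      where open ≤-Reasoning
    by-cases : Dec (e ≡ firstLeaf) → e ≡ firstLeaf
    by-cases (yes e≡) = e≡
    by-cases (no e≢) with collision e firstLeaf e≢ d≡
    ... | inj₁ adjacent = ⊥-elim (<⇒≱ (adjacent⇒far {e} {firstLeaf} adjacent) dist-firstLeaf≤n)
    ... | inj₂ adjacent = ⊥-elim (<⇒≱ (subst (n <_) d≡ (adjacent⇒far {firstLeaf} {e} adjacent)) dist-firstLeaf≤n)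

  colour-constant : StarConstant factor colour
  colour-constant _ _ _ = refl

  good : GoodFactor (suc (6 * n)) (3 * n)
  good = separated⇒good ≤-refl (n≤1+n h)
    (flipAt-separates factor (adjacent-apart⇒separates colours-apart) firstLeaf-lonely)
    (fromℕ< 0<n) (flipAt-mixes factor {j₁ = 1F} colour-constant (λ ()))
    (flipAt-mixed⇒here factor colour-constant)

module OddCase (h : ℕ) where

  open Construction h (suc h)

  colourBy : Bool → (x : ℕ) → Dec (x < h) → Bool
  colourBy weak x (yes _) = below weak (suc (2 * x)) h
  colourBy weak x (no _)  = below weak (2 * x) (3 * h)

  colour : Bool → ℕ → Bool
  colour weak x = colourBy weak x (x <? h)

  labelling : Labelling factor
  labelling (i , j) = colour (isMiddle j) (toℕ i)

  data Partners (x y : ℕ) : Set where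
    low  : suc (x + y) ≡ h → Partners x y
    high : h ≤ x → h ≤ y → x + y ≡ 3 * h → Partners x y

  partners-colour : ∀ b {x y} → Partners x y → colour b x ≡ not (colour (not b) y)
  partners-colour b {x} {y} (low sum) = by-cases (x <? h) (y <? h)
    where
    by-cases : (x<h? : Dec (x < h)) (y<h? : Dec (y < h)) → colourBy b x x<h? ≡ not (colourBy (not b) y y<h?)
    by-cases (yes _) (yes _) = below-complement b (begin
      suc (2 * x) + suc (2 * y)   ≡⟨ rearrange x y ⟩
      suc (x + y) + suc (x + y)   ≡⟨ cong₂ _+_ sum sum ⟩
      h + h                       ∎)
      where
      open ≡-Reasoning
      rearrange : ∀ x y → suc (2 * x) + suc (2 * y) ≡ suc (x + y) + suc (x + y)
      rearrange = solve-∀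
    by-cases (no x≮h) _       = ⊥-elim (x≮h (subst (x <_) sum (s≤s (m≤m+n x y))))
    by-cases (yes _)  (no y≮h) = ⊥-elim (y≮h (subst (y <_) sum (s≤s (m≤n+m y x))))
  partners-colour b {x} {y} (high h≤x h≤y sum) = by-cases (x <? h) (y <? h)
    where
    by-cases : (x<h? : Dec (x < h)) (y<h? : Dec (y < h)) → colourBy b x x<h? ≡ not (colourBy (not b) y y<h?)
    by-cases (no _) (no _) = below-complement b (begin
      2 * x + 2 * y   ≡⟨ *-distribˡ-+ 2 x y ⟨
      2 * (x + y)     ≡⟨ cong (2 *_) sum ⟩
      2 * (3 * h)     ≡⟨ cong (3 * h +_) (+-identityʳ (3 * h)) ⟩
      3 * h + 3 * h   ∎)
      where open ≡-Reasoning
    by-cases (yes x<h) _        = ⊥-elim (<⇒≱ x<h h≤x)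
    by-cases (no _)    (yes y<h) = ⊥-elim (<⇒≱ y<h h≤y)

  opposite-sum′ : ∀ i → toℕ i + toℕ (opposite i) ≡ h + h
  opposite-sum′ i = suc-injective (trans (opposite-sum i) (+-suc h h))

  shift-partners : ∀ {s s′ i i′} → reach s i ≡ n + reach s′ i′ → Partners (toℕ i) (toℕ i′)
  shift-partners {left} {right} {i} {i′} eq = high (subst (h ≤_) (sym i≡) (m≤m+n h ō′)) h≤i′ (begin
    toℕ i + toℕ i′          ≡⟨ cong (_+ toℕ i′) i≡ ⟩
    h + ō′ + toℕ i′         ≡⟨ rearrange h ō′ (toℕ i′) ⟩
    h + (toℕ i′ + ō′)       ≡⟨ cong (h +_) (opposite-sum′ i′) ⟩
    h + (h + h)             ≡⟨ cong (λ x → h + (h + x)) (+-identityʳ h) ⟨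
    3 * h                   ∎)
    where
    open ≡-Reasoning
    ō′ : ℕ
    ō′ = toℕ (opposite i′)
    shift : ∀ h x → h + suc h + suc (2 * x) ≡ 2 * suc (h + x)
    shift = solve-∀
    rearrange : ∀ h x y → h + x + y ≡ h + (y + x)
    rearrange = solve-∀
    i≡ : toℕ i ≡ h + ō′
    i≡ = suc-injective (*-cancelˡ-≡ (suc (toℕ i)) (suc (h + ō′)) 2 (trans eq (shift h ō′)))
    h≤i′ : h ≤ toℕ i′
    h≤i′ = ≮⇒≥ λ i′<h → <-irrefl (opposite-sum′ i′) (+-mono-<-≤ i′<h ō′≤h)
      where
      ō′≤h : ō′ ≤ h
      ō′≤h = ≤-pred (+-cancelˡ-< h ō′ (suc h) (subst (_< h + suc h) i≡ (toℕ<n i)))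
  shift-partners {right} {left} {i} {i′} eq = low (+-cancelʳ-≡ h (suc (toℕ i + toℕ i′)) h (begin
    suc (toℕ i + toℕ i′) + h      ≡⟨ rearrange (toℕ i) (toℕ i′) h ⟩
    toℕ i + (h + suc (toℕ i′))    ≡⟨ cong (toℕ i +_) ō≡ ⟨
    toℕ i + ō                     ≡⟨ opposite-sum′ i ⟩
    h + h                         ∎))
    where
    open ≡-Reasoning
    ō : ℕ
    ō = toℕ (opposite i)
    shift : ∀ h x → h + suc h + 2 * suc x ≡ suc (2 * (h + suc x))
    shift = solve-∀
    rearrange : ∀ x y h → suc (x + y) + h ≡ x + (h + suc y)
    rearrange = solve-∀
    ō≡ : ō ≡ h + suc (toℕ i′)
    ō≡ = *-cancelˡ-≡ ō (h + suc (toℕ i′)) 2 (suc-injective (trans eq (shift h (toℕ i′))))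
  shift-partners {left} {left} {i} {i′} eq =
    ⊥-elim (even≢odd (suc (toℕ i)) (h + suc (toℕ i′)) (trans eq (shift h (toℕ i′))))
    where
    shift : ∀ h x → h + suc h + 2 * suc x ≡ suc (2 * (h + suc x))
    shift = solve-∀
  shift-partners {right} {right} {i} {i′} eq =
    ⊥-elim (even≢odd (suc (h + toℕ (opposite i′))) (toℕ (opposite i)) (sym (trans eq (shift h (toℕ (opposite i′))))))
    where
    shift : ∀ h x → h + suc h + suc (2 * x) ≡ 2 * suc (h + x)
    shift = solve-∀

  labels-apart : ∀ e e′ → Adjacent e e′ → labelling e ≢ labelling e′
  labels-apart (i , j) (i′ , j′) (b′≡ , reach≡) same = not-¬ refl (begin
    labelling (i′ , j′)                                ≡⟨ same ⟨
    colour (isMiddle j) (toℕ i)                        ≡⟨ partners-colour (isMiddle j) partners ⟩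
    not (colour (not (isMiddle j)) (toℕ i′))           ≡⟨ cong (λ b → not (colour b (toℕ i′))) (isMiddle-flips b′≡) ⟨
    not (labelling (i′ , j′))                          ∎)
    where
    open ≡-Reasoning
    partners : Partners (toℕ i) (toℕ i′)
    partners = shift-partners {side i j} {side i′ j′} {i} {i′} reach≡

  mixed⇒colours-differ : ∀ {i} → MixedStar factor labelling i → colour true (toℕ i) ≢ colour false (toℕ i)
  mixed⇒colours-differ {i} (j , j′ , ℓj≡true , ℓj′≡false) =
    by-kind (isMiddle j) (isMiddle j′) ℓj≡true ℓj′≡false
    where
    by-kind : ∀ b b′ → colour b (toℕ i) ≡ true → colour b′ (toℕ i) ≡ false →
              colour true (toℕ i) ≢ colour false (toℕ i)
    by-kind true  true  t f _    = true≢false (trans (sym t) f)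
    by-kind false false t f _    = true≢false (trans (sym t) f)
    by-kind true  false t f same = true≢false (trans (sym t) (trans same f))
    by-kind false true  t f same = true≢false (trans (sym t) (trans (sym same) f))

  colours-differ⇒self-partner : ∀ {x} → colour true x ≢ colour false x → Partners x x
  colours-differ⇒self-partner {x} = by-half (x <? h)
    where
    x+x≡2x : x + x ≡ 2 * x
    x+x≡2x = cong (x +_) (sym (+-identityʳ x))
    by-half : (x<h? : Dec (x < h)) → colourBy true x x<h? ≢ colourBy false x x<h? → Partners x x
    by-half (yes _)  differ = low (trans (cong suc x+x≡2x) (below-strictness differ))
    by-half (no x≮h) differ = high (≮⇒≥ x≮h) (≮⇒≥ x≮h) (trans x+x≡2x (below-strictness differ))

  self-partner-unique : ∀ {x y} → Partners x x → Partners y y → x ≡ y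
  self-partner-unique (low x≡)      (low y≡)      = double-injective (suc-injective (trans x≡ (sym y≡)))
  self-partner-unique (high _ _ x≡) (high _ _ y≡) = double-injective (trans x≡ (sym y≡))
  self-partner-unique {x} {y} (low x≡) (high _ _ y≡) = ⊥-elim (even≢odd y (suc (3 * x)) (begin
    2 * y                    ≡⟨ cong (y +_) (+-identityʳ y) ⟩
    y + y                    ≡⟨ y≡ ⟩
    3 * h                    ≡⟨ cong (3 *_) x≡ ⟨
    3 * suc (x + x)          ≡⟨ rearrange x ⟩
    suc (2 * suc (3 * x))    ∎))
    where
    open ≡-Reasoning
    rearrange : ∀ x → 3 * suc (x + x) ≡ suc (2 * suc (3 * x))
    rearrange = solve-∀
  self-partner-unique (high h≤x h≤x′ x≡) (low y≡) = sym (self-partner-unique (low y≡) (high h≤x h≤x′ x≡))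

  self-partner : Σ (Fin n) λ i → Partners (toℕ i) (toℕ i)
  self-partner = by-parity (halve h)
    where
    by-parity : (∃ λ p → h ≡ 2 * p ⊎ h ≡ suc (2 * p)) → Σ (Fin n) λ i → Partners (toℕ i) (toℕ i)
    by-parity (p , inj₁ h≡) = fromℕ< 3p<n , subst (λ x → Partners x x) (sym (toℕ-fromℕ< 3p<n)) partners
      where
      grow : ∀ p → suc (3 * p + p) ≡ 2 * p + suc (2 * p)
      grow = solve-∀
      triple : ∀ p → 3 * p + 3 * p ≡ 3 * (2 * p)
      triple = solve-∀
      3p<n : 3 * p < n
      3p<n = begin-strict
        3 * p                 ≤⟨ m≤m+n (3 * p) p ⟩
        3 * p + p             <⟨ n<1+n (3 * p + p) ⟩
        suc (3 * p + p)       ≡⟨ grow p ⟩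
        2 * p + suc (2 * p)   ≡⟨ cong (λ m → m + suc m) h≡ ⟨
        h + suc h             ∎
        where open ≤-Reasoning
      h≤3p : h ≤ 3 * p
      h≤3p = subst (_≤ 3 * p) (sym h≡) (*-monoˡ-≤ p {2} {3} (s≤s (s≤s z≤n)))
      partners : Partners (3 * p) (3 * p)
      partners = high h≤3p h≤3p (trans (triple p) (cong (3 *_) (sym h≡)))
    by-parity (p , inj₂ h≡) = fromℕ< p<n , subst (λ x → Partners x x) (sym (toℕ-fromℕ< p<n)) partners
      where
      p<n : p < n
      p<n = begin-strict
        p                 <⟨ s≤s (m≤m+n p (p + 0)) ⟩
        suc (2 * p)       ≡⟨ h≡ ⟨
        h                 ≤⟨ m≤m+n h (suc h) ⟩
        h + suc h         ∎
        where open ≤-Reasoning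
      partners : Partners p p
      partners = low (trans (cong (λ x → suc (p + x)) (sym (+-identityʳ p))) (sym h≡))

  self-partner-mixed : ∀ {i} → Partners (toℕ i) (toℕ i) → MixedStar factor labelling i
  self-partner-mixed {i} partners =
    complementary⇒mixed factor {labelling} {i} {2F} {0F} (partners-colour true partners)

  mixed⇒self-partner : ∀ {i} → MixedStar factor labelling i → Partners (toℕ i) (toℕ i)
  mixed⇒self-partner = colours-differ⇒self-partner ∘ mixed⇒colours-differ

  good : GoodFactor (suc (6 * n)) (3 * n)
  good = separated⇒good (n≤1+n h) ≤-refl (adjacent-apart⇒separates labels-apart)
    (proj₁ self-partner) (self-partner-mixed (proj₂ self-partner))
    (λ _ mixed → toℕ-injective (self-partner-unique (mixed⇒self-partner mixed) (proj₂ self-partner)))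

almost-star-factor : ∀ n → 1 ≤ n → GoodFactor (suc (6 * n)) (3 * n)
almost-star-factor n 1≤n = by-parity (halve n)
  where
  Good : ℕ → Set
  Good m = GoodFactor (suc (6 * m)) (3 * m)
  by-parity : (∃ λ h → n ≡ 2 * h ⊎ n ≡ suc (2 * h)) → Good n
  by-parity (zero , inj₁ n≡0) = ⊥-elim (<⇒≱ 1≤n (≤-reflexive n≡0))
  by-parity (suc h , inj₁ n≡) =
    subst Good (trans (cong (suc h +_) (sym (+-identityʳ (suc h)))) (sym n≡)) (EvenCase.good (suc h) (s≤s z≤n))
  by-parity (h , inj₂ n≡) =
    subst Good (trans (+-suc h h) (trans (cong (λ x → suc (h + x)) (sym (+-identityʳ h))) (sym n≡))) (OddCase.good h)

lemma3p1 : (m : ℕ) → 1 ≤ m →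
    Σ (AlmostStarFactor1 (30 * m + 7)) λ F →
    ((d : ℕ) → 1 ≤ d → d ≤ 15 * m + 3 → Σ (Edge F) λ e → HasForwardDiff F e d)
    × ((d : ℕ) → 1 ≤ d → d ≤ 15 * m + 3 → (e₁ e₂ e₃ : Edge F) →
    e₁ ≢ e₂ → e₁ ≢ e₃ → e₂ ≢ e₃ →
    HasForwardDiff F e₁ d → HasForwardDiff F e₂ d → ¬ HasForwardDiff F e₃ d)
    × ((e : Edge F) → IsForward F e)
    × Σ (Labelling F) λ ℓ → IsPurePrimeLabelling F ℓ
    × Σ (Fin (k F)) λ i → MixedStar F ℓ i
    × ((i' : Fin (k F)) → MixedStar F ℓ i' → i' ≡ i)
lemma3p1 m _ = subst₂ GoodFactor (vertices≡ m) (differences≡ m) (almost-star-factor (suc (5 * m)) (s≤s z≤n))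
  where
  vertices≡ : ∀ m → suc (6 * suc (5 * m)) ≡ 30 * m + 7
  vertices≡ = solve-∀
  differences≡ : ∀ m → 3 * suc (5 * m) ≡ 15 * m + 3
  differences≡ = solve-∀
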